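{- Let $f=(x,y,z,w)$ be a binary constraint, i.e. $f(00)=x$, $f(01)=y$, $f(10)=z$, $f(11)=w$ with $x,y,z,w\in\mathbb{R}^{\ge0}$. If $xw>yz$, then $f\in\mathcal{IM}_{opt}$.
   Context: A constraint of arity $k$ is a function $\{0,1\}^k\to\mathbb{R}^{\ge0}$. $\mathcal{IM}_{opt}$ is the set of constraints that are products (applied to variables) of unary constraints and binary constraints of the form $(1,1,\lambda,1)$ with $0\le\lambda<1$, where a binary constraint $h$ is written $(h(00),h(01),h(10),h(11))$. -}

module Defs where

open import Data.Nat using (ℕ)
open import Level using (Level; _⊔_) renaming (suc to lsuc)
open import Data.Bool using (Bool; true; false)
open import Data.Fin using (Fin; zero; suc)
open import Data.List using (List; foldr; map)
open import Data.Product using (Σ; _×_)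
open import Data.Sum using (_⊎_)
open import Relation.Binary.PropositionalEquality using (_≡_)
open import Relation.Binary.Core using (Rel)
open import Relation.Binary.Definitions using (Trichotomous)
open import Relation.Nullary using (¬_)

-- An ordered field (with propositional equality).  ℝ is an instance;
-- the theorem is stated for every ordered field, hence in particular for ℝ.
record OrderedField (c : Level) : Set (lsuc c) where
  infixl 6 _+_
  infixl 7 _*_
  infix 4 _<_
  field
    Carrier : Set c
    0# 1#   : Carrier
    _+_ _*_ : Carrier → Carrier → Carrier
    -_      : Carrier → Carrier
    _⁻¹     : Carrier → Carrier
    _<_     : Rel Carrier c
    +-assoc     : ∀ a b c → (a + b) + c ≡ a + (b + c)
    +-comm      : ∀ a b → a + b ≡ b + a
    +-identityˡ : ∀ a → 0# + a ≡ a
    +-inverseˡ  : ∀ a → (- a) + a ≡ 0#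
    *-assoc     : ∀ a b c → (a * b) * c ≡ a * (b * c)
    *-comm      : ∀ a b → a * b ≡ b * a
    *-identityˡ : ∀ a → 1# * a ≡ a
    distribˡ    : ∀ a b c → a * (b + c) ≡ a * b + a * c
    0≢1         : ¬ (0# ≡ 1#)
    *-inverseʳ  : ∀ a → ¬ (a ≡ 0#) → a * (a ⁻¹) ≡ 1#
    <-irrefl    : ∀ a → ¬ (a < a)
    <-trans     : ∀ {a b c} → a < b → b < c → a < c
    <-tri       : Trichotomous _≡_ _<_
    +-mono-<    : ∀ {a b} c → a < b → a + c < b + c
    *-pos       : ∀ {a b} → 0# < a → 0# < b → 0# < a * b

  infix 4 _≤_
  _≤_ : Rel Carrier c
  a ≤ b = (a < b) ⊎ (a ≡ b)

module _ {c : Level} (F : OrderedField c) where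
  open OrderedField F

  -- An assignment of Boolean values (false = 0, true = 1) to k variables.
  Assignment : ℕ → Set
  Assignment k = Fin k → Bool

  -- A constraint of arity k (values are meant to be in F≥0).
  Constraint : ℕ → Set c
  Constraint k = Assignment k → Carrier

  binary : Carrier → Carrier → Carrier → Carrier → Constraint 2
  binary x y z w σ with σ zero | σ (suc zero)
  ... | false | false = x
  ... | false | true  = y
  ... | true  | false = z
  ... | true  | true  = w

  -- Building blocks of IM_opt, applied to variables among the k variables:
  --  * a unary constraint u : {0,1} → F≥0 applied to variable i;
  --  * a binary constraint (1,1,λ,1) with 0 ≤ λ < 1 applied to (i , j).
  data Atom (k : ℕ) : Set c where
    unary : (u : Bool → Carrier) → (∀ b → 0# ≤ u b) → Fin k → Atom k
    imp   : (λ' : Carrier) → 0# ≤ λ' → λ' < 1# → Fin k → Fin k → Atom k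

  impVal : Carrier → Bool → Bool → Carrier
  impVal λ' true false = λ'
  impVal λ' _    _     = 1#

  evalAtom : ∀ {k} → Atom k → Assignment k → Carrier
  evalAtom (unary u _ i) σ = u (σ i)
  evalAtom (imp λ' _ _ i j) σ = impVal λ' (σ i) (σ j)

  evalAtoms : ∀ {k} → List (Atom k) → Assignment k → Carrier
  evalAtoms as σ = foldr (λ a r → evalAtom a σ * r) 1# as

  IMopt : ∀ {k} → Constraint k → Set c
  IMopt {k} f = Σ (List (Atom k)) λ as → ∀ σ → f σ ≡ evalAtoms as σ

module Submission where

-- Write t(a,b) for the two-variable table (x,y,z,w).  The class
-- IM_opt contains every atom and is closed under pointwise products and
-- pointwise equality, so it suffices to factor t into atoms.  From
-- yz < xw and non-negativity, x > 0 and w > 0.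
--  * If y > 0, then t(a,b) = u(a) · v(b) · (1,1,λ,1)(a,b) with
--    u = (1, w/y), v = (x, y) and λ = z/P where P = (w/y)·x; since
--    P·y = xw > yz, we get z < P, i.e. λ < 1.
--  * If y = 0 < z, the transposed table (x,z,y,w) read on the swapped
--    variables is the same constraint, and the previous case applies.
--  * If y = z = 0, then t(a,b) = (x,w)(a) · (1,1,0,1)(a,b) · (1,1,0,1)(b,a).

open import Defs
open import Level using (Level)
open import Data.Bool using (Bool; true; false; if_then_else_)
open import Data.Fin using (Fin; zero; suc)
open import Data.List using (List; []; _∷_; _++_)
open import Data.Product using (_,_)
open import Data.Sum using (inj₁; inj₂)
open import Data.Empty using (⊥-elim)
open import Relation.Nullary using (¬_)
open import Relation.Binary.PropositionalEquality
  using (_≡_; refl; sym; trans; cong; cong₂; subst; subst₂; module ≡-Reasoning)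
open import Relation.Binary.Definitions using (tri<; tri≈; tri>)

module FieldFacts {c : Level} (F : OrderedField c) where
  open OrderedField F
  open ≡-Reasoning

  *-identityʳ : ∀ a → a * 1# ≡ a
  *-identityʳ a = trans (*-comm a 1#) (*-identityˡ a)

  +-identityʳ : ∀ a → a + 0# ≡ a
  +-identityʳ a = trans (+-comm a 0#) (+-identityˡ a)

  +-inverseʳ : ∀ a → a + (- a) ≡ 0#
  +-inverseʳ a = trans (+-comm a (- a)) (+-inverseˡ a)

  distribʳ : ∀ a b c → (b + c) * a ≡ b * a + c * a
  distribʳ a b c = trans (*-comm (b + c) a)
    (trans (distribˡ a b c) (cong₂ _+_ (*-comm a b) (*-comm a c)))

  -- t = a·0 satisfies t = t + t, hence t = 0.
  zeroʳ : ∀ a → a * 0# ≡ 0#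
  zeroʳ a = sym (begin
      0#              ≡⟨ sym (+-inverseˡ t) ⟩
      (- t) + t       ≡⟨ cong ((- t) +_) t≡t+t ⟩
      (- t) + (t + t) ≡⟨ sym (+-assoc (- t) t t) ⟩
      ((- t) + t) + t ≡⟨ cong (_+ t) (+-inverseˡ t) ⟩
      0# + t          ≡⟨ +-identityˡ t ⟩
      t               ∎)
    where
    t = a * 0#
    t≡t+t : t ≡ t + t
    t≡t+t = trans (cong (a *_) (sym (+-identityˡ 0#))) (distribˡ a 0# 0#)

  zeroˡ : ∀ a → 0# * a ≡ 0#
  zeroˡ a = trans (*-comm 0# a) (zeroʳ a)

  inverse-unique : ∀ u v → u + v ≡ 0# → u ≡ - v
  inverse-unique u v u+v≡0 = begin
    u              ≡⟨ sym (+-identityʳ u) ⟩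
    u + 0#         ≡⟨ cong (u +_) (sym (+-inverseʳ v)) ⟩
    u + (v + - v)  ≡⟨ sym (+-assoc u v (- v)) ⟩
    (u + v) + - v  ≡⟨ cong (_+ - v) u+v≡0 ⟩
    0# + - v       ≡⟨ +-identityˡ (- v) ⟩
    - v            ∎

  -‿distribˡ-* : ∀ a b → (- a) * b ≡ - (a * b)
  -‿distribˡ-* a b = inverse-unique _ _ (trans (sym (distribʳ b (- a) a))
    (trans (cong (_* b) (+-inverseˡ a)) (zeroˡ b)))

  -‿involutive : ∀ a → - (- a) ≡ a
  -‿involutive a = sym (inverse-unique a (- a) (+-inverseʳ a))

  <⇒0<difference : ∀ {a b} → a < b → 0# < b + - a
  <⇒0<difference {a} {b} a<b = subst (_< b + - a) (+-inverseʳ a) (+-mono-< (- a) a<b)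

  0<difference⇒< : ∀ {a b} → 0# < b + - a → a < b
  0<difference⇒< {a} {b} 0<b-a = subst₂ _<_ (+-identityˡ a) b-a+a≡b (+-mono-< a 0<b-a)
    where
    b-a+a≡b : (b + - a) + a ≡ b
    b-a+a≡b = trans (+-assoc b (- a) a)
      (trans (cong (b +_) (+-inverseˡ a)) (+-identityʳ b))

  *-monoʳ-< : ∀ {a b c} → 0# < c → a < b → a * c < b * c
  *-monoʳ-< {a} {b} {c} 0<c a<b =
    0<difference⇒< (subst (0# <_) expand (*-pos (<⇒0<difference a<b) 0<c))
    where
    expand : (b + - a) * c ≡ b * c + - (a * c)
    expand = trans (distribʳ c b (- a)) (cong (b * c +_) (-‿distribˡ-* a c))

  *-cancelʳ-< : ∀ {a b c} → 0# < c → a * c < b * c → a < b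
  *-cancelʳ-< {a} {b} 0<c ac<bc with <-tri a b
  ... | tri< a<b _ _ = a<b
  ... | tri≈ _ refl _ = ⊥-elim (<-irrefl _ ac<bc)
  ... | tri> _ _ b<a = ⊥-elim (<-irrefl _ (<-trans ac<bc (*-monoʳ-< 0<c b<a)))

  -- If 1 < 0 then 0 < -1, so 0 < (-1)·(-1) = 1, a contradiction.
  0<1 : 0# < 1#
  0<1 with <-tri 0# 1#
  ... | tri< 0<1 _ _ = 0<1
  ... | tri≈ _ 0≡1 _ = ⊥-elim (0≢1 0≡1)
  ... | tri> _ _ 1<0 = ⊥-elim (<-irrefl _ (<-trans 1<0 0<square))
    where
    0<-1 : 0# < - 1#
    0<-1 = subst (0# <_) (+-identityˡ (- 1#)) (<⇒0<difference 1<0)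
    square : (- 1#) * (- 1#) ≡ 1#
    square = trans (-‿distribˡ-* 1# (- 1#))
      (trans (cong -_ (*-identityˡ (- 1#))) (-‿involutive 1#))
    0<square : 0# < 1#
    0<square = subst (0# <_) square (*-pos 0<-1 0<-1)

  positive⇒nonzero : ∀ {a} → 0# < a → ¬ (a ≡ 0#)
  positive⇒nonzero 0<a refl = <-irrefl _ 0<a

  *-inverseˡ : ∀ {a} → 0# < a → a ⁻¹ * a ≡ 1#
  *-inverseˡ {a} 0<a = trans (*-comm (a ⁻¹) a) (*-inverseʳ a (positive⇒nonzero 0<a))

  division-cancel : ∀ b {a} → 0# < a → (b * a ⁻¹) * a ≡ b
  division-cancel b {a} 0<a =
    trans (*-assoc b (a ⁻¹) a) (trans (cong (b *_) (*-inverseˡ 0<a)) (*-identityʳ b))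

  ⁻¹-positive : ∀ {a} → 0# < a → 0# < a ⁻¹
  ⁻¹-positive {a} 0<a with <-tri 0# (a ⁻¹)
  ... | tri< 0<a⁻¹ _ _ = 0<a⁻¹
  ... | tri≈ _ 0≡a⁻¹ _ = ⊥-elim (0≢1 (begin
    0#         ≡⟨ sym (zeroʳ a) ⟩
    a * 0#     ≡⟨ cong (a *_) 0≡a⁻¹ ⟩
    a * a ⁻¹   ≡⟨ *-inverseʳ a (positive⇒nonzero 0<a) ⟩
    1#         ∎))
  ... | tri> _ _ a⁻¹<0 = ⊥-elim (<-irrefl _ (<-trans 0<1
    (subst₂ _<_ (*-inverseˡ 0<a) (zeroˡ a) (*-monoʳ-< 0<a a⁻¹<0))))

  quotient<1 : ∀ {a b} → 0# < a → b < a → b * a ⁻¹ < 1#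
  quotient<1 {a} {b} 0<a b<a = *-cancelʳ-< 0<a
    (subst₂ _<_ (sym (division-cancel b 0<a)) (sym (*-identityˡ a)) b<a)

  0≤-* : ∀ {a b} → 0# ≤ a → 0# ≤ b → 0# ≤ a * b
  0≤-* (inj₁ 0<a) (inj₁ 0<b) = inj₁ (*-pos 0<a 0<b)
  0≤-* {a} (inj₁ _) (inj₂ refl) = inj₂ (sym (zeroʳ a))
  0≤-* {b = b} (inj₂ refl) _ = inj₂ (sym (zeroˡ b))

  ≤-<-trans : ∀ {a b c} → a ≤ b → b < c → a < c
  ≤-<-trans (inj₁ a<b) b<c = <-trans a<b b<c
  ≤-<-trans (inj₂ refl) b<c = b<c

  positive-factorˡ : ∀ {a b d} → 0# ≤ a → 0# ≤ d → d < a * b → 0# < a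
  positive-factorˡ (inj₁ 0<a) _ _ = 0<a
  positive-factorˡ {b = b} (inj₂ refl) 0≤d d<0b =
    ⊥-elim (<-irrefl _ (≤-<-trans 0≤d (subst (_ <_) (zeroˡ b) d<0b)))

  positive-factorʳ : ∀ {a b d} → 0# ≤ b → 0# ≤ d → d < a * b → 0# < b
  positive-factorʳ {a} {b} 0≤b 0≤d d<ab =
    positive-factorˡ 0≤b 0≤d (subst (_ <_) (*-comm a b) d<ab)

module IMoptClosure {c : Level} (F : OrderedField c) where
  open OrderedField F
  open FieldFacts F
  open ≡-Reasoning

  IMopt-resp : ∀ {k} {f g : Constraint F k} → (∀ σ → f σ ≡ g σ) → IMopt F g → IMopt F f
  IMopt-resp f≗g (as , g≗as) = as , λ σ → trans (f≗g σ) (g≗as σ)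

  IMopt-atom : ∀ {k} (a : Atom F k) → IMopt F (evalAtom F a)
  IMopt-atom a = a ∷ [] , λ σ → sym (*-identityʳ (evalAtom F a σ))

  evalAtoms-++ : ∀ {k} (as bs : List (Atom F k)) σ →
    evalAtoms F as σ * evalAtoms F bs σ ≡ evalAtoms F (as ++ bs) σ
  evalAtoms-++ [] bs σ = *-identityˡ (evalAtoms F bs σ)
  evalAtoms-++ (a ∷ as) bs σ = begin
    (evalAtom F a σ * evalAtoms F as σ) * evalAtoms F bs σ
      ≡⟨ *-assoc (evalAtom F a σ) _ _ ⟩
    evalAtom F a σ * (evalAtoms F as σ * evalAtoms F bs σ)
      ≡⟨ cong (evalAtom F a σ *_) (evalAtoms-++ as bs σ) ⟩
    evalAtom F a σ * evalAtoms F (as ++ bs) σ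
      ∎

  IMopt-* : ∀ {k} {f g : Constraint F k} → IMopt F f → IMopt F g →
    IMopt F (λ σ → f σ * g σ)
  IMopt-* (as , f≗as) (bs , g≗bs) =
    as ++ bs , λ σ → trans (cong₂ _*_ (f≗as σ) (g≗bs σ)) (evalAtoms-++ as bs σ)

module Factorisation {c : Level} (F : OrderedField c) where
  open OrderedField F
  open FieldFacts F
  open IMoptClosure F
  open ≡-Reasoning

  table : Carrier → Carrier → Carrier → Carrier → Bool → Bool → Carrier
  table x y z w false false = x
  table x y z w false true  = y
  table x y z w true  false = z
  table x y z w true  true  = w

  pair : Carrier → Carrier → Bool → Carrier
  pair p q b = if b then q else p

  pair-nonneg : ∀ {p q} → 0# ≤ p → 0# ≤ q → ∀ b → 0# ≤ pair p q b
  pair-nonneg 0≤p _ false = 0≤p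
  pair-nonneg _ 0≤q true  = 0≤q

  binary-table : ∀ x y z w σ → binary F x y z w σ ≡ table x y z w (σ zero) (σ (suc zero))
  binary-table x y z w σ with σ zero | σ (suc zero)
  ... | false | false = refl
  ... | false | true  = refl
  ... | true  | false = refl
  ... | true  | true  = refl

  table-transpose : ∀ x y z w a b → table x y z w a b ≡ table x z y w b a
  table-transpose x y z w false false = refl
  table-transpose x y z w false true  = refl
  table-transpose x y z w true  false = refl
  table-transpose x y z w true  true  = refl

  IMopt-table-offdiagonal : ∀ {k} x y z w → 0# ≤ x → 0# < y → 0# ≤ z → 0# ≤ w →
    y * z < x * w → (i j : Fin k) → IMopt F (λ σ → table x y z w (σ i) (σ j))
  IMopt-table-offdiagonal x y z w 0≤x 0<y 0≤z 0≤w yz<xw i j =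
    IMopt-resp (λ σ → factorise (σ i) (σ j))
      (IMopt-* (IMopt-atom (unary (pair 1# a) (pair-nonneg (inj₁ 0<1) (inj₁ 0<a)) i))
        (IMopt-* (IMopt-atom (unary (pair x y) (pair-nonneg 0≤x (inj₁ 0<y)) j))
          (IMopt-atom (imp λ' 0≤λ λ<1 i j))))
    where
    a = w * y ⁻¹
    0<a : 0# < a
    0<a = *-pos (positive-factorʳ 0≤w (0≤-* (inj₁ 0<y) 0≤z) yz<xw) (⁻¹-positive 0<y)
    P = a * x
    0<P : 0# < P
    0<P = *-pos 0<a (positive-factorˡ 0≤x (0≤-* (inj₁ 0<y) 0≤z) yz<xw)
    λ' = z * P ⁻¹
    0≤λ : 0# ≤ λ'
    0≤λ = 0≤-* 0≤z (inj₁ (⁻¹-positive 0<P))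
    P·y≡x·w : P * y ≡ x * w
    P·y≡x·w = begin
      (a * x) * y ≡⟨ cong (_* y) (*-comm a x) ⟩
      (x * a) * y ≡⟨ *-assoc x a y ⟩
      x * (a * y) ≡⟨ cong (x *_) (division-cancel w 0<y) ⟩
      x * w       ∎
    λ<1 : λ' < 1#
    λ<1 = quotient<1 0<P (*-cancelʳ-< 0<y (subst₂ _<_ (*-comm y z) (sym P·y≡x·w) yz<xw))
    factorise : ∀ p q →
      table x y z w p q ≡ pair 1# a p * (pair x y q * impVal F λ' p q)
    factorise false false = sym (trans (*-identityˡ _) (*-identityʳ x))
    factorise false true  = sym (trans (*-identityˡ _) (*-identityʳ y))
    factorise true  false = sym (begin
      a * (x * λ') ≡⟨ sym (*-assoc a x λ') ⟩
      P * λ'       ≡⟨ *-comm P λ' ⟩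
      λ' * P       ≡⟨ division-cancel z 0<P ⟩
      z            ∎)
    factorise true  true  = sym (trans (cong (a *_) (*-identityʳ y)) (division-cancel w 0<y))

  IMopt-table-diagonal : ∀ {k} x w → 0# ≤ x → 0# ≤ w →
    (i j : Fin k) → IMopt F (λ σ → table x 0# 0# w (σ i) (σ j))
  IMopt-table-diagonal x w 0≤x 0≤w i j =
    IMopt-resp (λ σ → factorise (σ i) (σ j))
      (IMopt-* (IMopt-atom (unary (pair x w) (pair-nonneg 0≤x 0≤w) i))
        (IMopt-* (IMopt-atom (imp 0# (inj₂ refl) 0<1 i j))
          (IMopt-atom (imp 0# (inj₂ refl) 0<1 j i))))
    where
    factorise : ∀ p q →
      table x 0# 0# w p q ≡ pair x w p * (impVal F 0# p q * impVal F 0# q p)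
    factorise false false = sym (trans (cong (x *_) (*-identityˡ 1#)) (*-identityʳ x))
    factorise false true  = sym (trans (cong (x *_) (zeroʳ 1#)) (zeroʳ x))
    factorise true  false = sym (trans (cong (w *_) (zeroˡ 1#)) (zeroʳ w))
    factorise true  true  = sym (trans (cong (w *_) (*-identityˡ 1#)) (*-identityʳ w))

lemma2p1 : {c : Level} (F : OrderedField c) →
    let open OrderedField F in
    (x y z w : Carrier) →
    0# ≤ x → 0# ≤ y → 0# ≤ z → 0# ≤ w →
    y * z < x * w →
    IMopt F (binary F x y z w)
lemma2p1 F x y z w 0≤x (inj₁ 0<y) 0≤z 0≤w yz<xw =
  IMopt-resp (binary-table x y z w)
    (IMopt-table-offdiagonal x y z w 0≤x 0<y 0≤z 0≤w yz<xw zero (suc zero))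
  where
  open IMoptClosure F
  open Factorisation F
lemma2p1 F x y z w 0≤x (inj₂ y≡0) (inj₁ 0<z) 0≤w yz<xw =
  IMopt-resp (λ σ → trans (binary-table x y z w σ) (table-transpose x y z w _ _))
    (IMopt-table-offdiagonal x z y w 0≤x 0<z (inj₂ y≡0) 0≤w zy<xw (suc zero) zero)
  where
  open OrderedField F
  open IMoptClosure F
  open Factorisation F
  zy<xw : z * y < x * w
  zy<xw = subst (_< x * w) (*-comm y z) yz<xw
lemma2p1 F x y z w 0≤x (inj₂ refl) (inj₂ refl) 0≤w _ =
  IMopt-resp (binary-table x _ _ w)
    (IMopt-table-diagonal x w 0≤x 0≤w zero (suc zero))
  where
  open IMoptClosure F
  open Factorisation F
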